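{- Let $F=(T_1,T_2,\dots,T_r)$, $r\ge1$, be an ordered forest of complete binary trees, and let $O$ denote the tree with a single node. Then \[ p(F)=p(T_1)\cdot p(O,T_2,\dots,T_r), \] where $T_1$ is regarded as a forest with one tree.
   Context: A complete binary tree is a rooted plane tree in which every node has either $0$ or $2$ (ordered: left and right) children; internal nodes are those with $2$ children. An ordered forest is a finite sequence of such trees. Given a forest $G$ with $N$ nodes in total, label its nodes $1,\dots,N$ in left suffix (postorder) order: trees from left to right, and within a tree, first the left subtree of a node, then its right subtree, then the node itself. Let $S(G)$ be the set of labels of internal nodes of $G$ (this is always a pinnacle set). Define $p(G)=p_N(S(G))$, where for a finite set $S$ of positive integers, $p_N(S)$ is the number of permutations $\sigma=\sigma_1\cdots\sigma_N$ of $\{1,\dots,N\}$ whose pinnacle set $\{\sigma_i\mid 1<i<N,\ \sigma_{i-1}<\sigma_i>\sigma_{i+1}\}$ equals $S$. -}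

module Defs where

open import Data.Nat using (ℕ; zero; suc; _+_; _*_; _≡ᵇ_; _<ᵇ_)
open import Data.Bool using (Bool; true; false; _∧_; if_then_else_)
open import Data.List using (List; []; _∷_; _++_; [_]; concatMap; map; length; filterᵇ; applyUpTo)
open import Data.Bool.ListAction using (all; any)

data Tree : Set where
  leaf : Tree
  node : Tree → Tree → Tree

Forest : Set
Forest = List Tree

size : Tree → ℕ
size leaf       = 1
size (node l r) = size l + size r + 1

forestSize : Forest → ℕ
forestSize []       = 0
forestSize (t ∷ ts) = size t + forestSize ts

-- Labels of internal nodes of a tree whose nodes are labelled in postorder
-- by k+1, …, k+size t (offset k).
internalsT : ℕ → Tree → List ℕ
internalsT k leaf       = []
internalsT k (node l r) =
  internalsT k l ++ internalsT (k + size l) r ++ [ k + size l + size r + 1 ]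

internalsF : ℕ → Forest → List ℕ
internalsF k []       = []
internalsF k (t ∷ ts) = internalsT k t ++ internalsF (k + size t) ts

S : Forest → List ℕ
S G = internalsF 0 G

insertEverywhere : ℕ → List ℕ → List (List ℕ)
insertEverywhere x []       = (x ∷ []) ∷ []
insertEverywhere x (y ∷ ys) = (x ∷ y ∷ ys) ∷ map (y ∷_) (insertEverywhere x ys)

perms : List ℕ → List (List ℕ)
perms []       = [] ∷ []
perms (x ∷ xs) = concatMap (insertEverywhere x) (perms xs)

oneTo : ℕ → List ℕ
oneTo N = applyUpTo suc N

pinnacles : List ℕ → List ℕ
pinnacles (a ∷ b ∷ c ∷ rest) =
  (if (a <ᵇ b) ∧ (c <ᵇ b) then b ∷ [] else []) ++ pinnacles (b ∷ c ∷ rest)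
pinnacles _ = []

_∈ᵇ_ : ℕ → List ℕ → Bool
x ∈ᵇ ys = any (x ≡ᵇ_) ys

sameSet : List ℕ → List ℕ → Bool
sameSet xs ys = all (_∈ᵇ ys) xs ∧ all (_∈ᵇ xs) ys

pN : ℕ → List ℕ → ℕ
pN N s = length (filterᵇ (λ σ → sameSet (pinnacles σ) s) (perms (oneTo N)))

p : Forest → ℕ
p G = pN (forestSize G) (S G)

-- Let T₁ have n = k + 1 nodes, so that S(T₁) ⊆ [1, n] has (n − 1)/2 elements, and let N be the number
-- of nodes of F; the labels of T₂, …, T_r in F are those in (O, T₂, …, T_r) shifted by k.  Gluing a
-- permutation u of [1, n] into a permutation τ of [1, N − k], i.e. replacing the entry 1 of τ by the block
-- u and shifting the other entries by k, gives a permutation of [1, N] whose pinnacles are those of u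
-- together with the shifted pinnacles of τ.  Conversely, let σ have pinnacle set S(F).  Its entries ≤ n
-- include (n − 1)/2 pinnacles, and since a small pinnacle has two small neighbours and pinnacles are never
-- adjacent, a maximal run of m small entries carries at most (m − 1)/2 of them.  So the small entries of
-- σ form a single run, and σ is glued.  Gluing is therefore a bijection onto the permutations counted by
-- p(F).

module Submission where

open import Defs
open import Data.Bool using (Bool; true; false; T; _∧_; not; if_then_else_)
open import Data.Bool.ListAction using (all; any)
open import Data.Bool.Properties using (T-∧; T-≡; ∧-zeroʳ)
open import Data.Empty using (⊥; ⊥-elim)
open import Data.List using (List; []; _∷_; _++_; [_]; map; length; concatMap; applyUpTo; filter; filterᵇ; cartesianProductWith)
import Data.List.Properties as List
open import Data.List.Membership.Propositional using (_∈_; _∉_; find; lose)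
open import Data.List.Membership.Propositional.Properties using (∈-map⁺; ∈-map⁻; ∈-++⁺ˡ; ∈-++⁺ʳ; ∈-++⁻; ∈-∃++; ∈-concatMap⁺; ∈-concatMap⁻; ∈-cartesianProductWith⁺; ∈-cartesianProductWith⁻; ∈-applyUpTo⁻; ∈-filter⁺; ∈-filter⁻)
open import Data.List.Membership.Propositional.Properties.WithK using (unique∧set⇒bag)
open import Data.List.Relation.Binary.BagAndSetEquality using (_∼[_]_; set; bag-=⇒; ↭⇒∼bag; ∼bag⇒↭; ++-cong; map-cong; [_]-Equality)
open import Data.List.Relation.Binary.Permutation.Propositional using (_↭_; ↭-refl; ↭-sym; ↭-trans; ↭-reflexive; prep; module PermutationReasoning)
open import Data.List.Relation.Binary.Permutation.Propositional.Properties using (∈-resp-↭; shift; shifts; drop-mid; drop-∷; ↭-empty-inv; ↭-length; ++⁺; ++⁺ˡ; map⁺; filter-↭; ¬x∷xs↭[])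
open import Data.List.Relation.Binary.Subset.Propositional using (_⊆_)
open import Data.List.Relation.Unary.All as All using (All; []; _∷_)
import Data.List.Relation.Unary.All.Properties as All
import Data.List.Relation.Unary.Any as Any
open import Data.List.Relation.Unary.Any using (here; there)
open import Data.List.Relation.Unary.Any.Properties using (any⁺; any⁻)
open import Data.List.Relation.Unary.Unique.Propositional using (Unique; []; _∷_)
import Data.List.Relation.Unary.Unique.Propositional.Properties as Unique
open import Data.Nat using (ℕ; zero; suc; _+_; _*_; _∸_; _≤_; _<_; _≤ᵇ_; _<ᵇ_; _≡ᵇ_; _≤?_; s≤s; z≤n; z<s)
open import Data.Nat.Properties
open import Data.Nat.Tactic.RingSolver using (solve-∀)
open import Data.Product using (∃; ∃₂; _×_; _,_; proj₁; proj₂)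
open import Data.Sum using (inj₁; inj₂)
open import Function using (_∘_)
open import Function.Bundles using (_⇔_; mk⇔; Equivalence)
open import Relation.Binary.Bundles using (Setoid)
open import Relation.Binary.PropositionalEquality using (_≡_; refl; sym; trans; cong; cong₂; subst; module ≡-Reasoning)
open import Relation.Nullary using (¬_)
open import Relation.Nullary.Decidable using (T?)
open import Relation.Unary using (∁)

private
  variable
    A B C : Set

Unique-map⁺-on : ∀ (f : A → B) {xs} → (∀ {x y} → x ∈ xs → y ∈ xs → f x ≡ f y → x ≡ y) →
                 Unique xs → Unique (map f xs)
Unique-map⁺-on f _   []         = []
Unique-map⁺-on f {xs = x ∷ xs} inj (x∉ ∷ xs!) =
  All.tabulate fresh ∷ Unique-map⁺-on f (λ p q → inj (there p) (there q)) xs!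
  where
  fresh : ∀ {v} → v ∈ map f xs → ¬ f x ≡ v
  fresh v∈ fx≡v with ∈-map⁻ f v∈
  ... | y , y∈ , refl = All.lookup x∉ y∈ (inj (here refl) (there y∈) fx≡v)

concatMap-unique : ∀ (f : A → List B) {xs} → Unique xs → (∀ {x} → x ∈ xs → Unique (f x)) →
                   (∀ {x y v} → x ∈ xs → y ∈ xs → v ∈ f x → v ∈ f y → x ≡ y) →
                   Unique (concatMap f xs)
concatMap-unique f []         _  _    = []
concatMap-unique f {xs = x ∷ xs} (x∉ ∷ xs!) f! f#f =
  Unique.++⁺ (f! (here refl)) (concatMap-unique f xs! (f! ∘ there) (λ p q → f#f (there p) (there q)))
    disjoint
  where
  disjoint : ∀ {v} → ¬ (v ∈ f x × v ∈ concatMap f xs)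
  disjoint (v∈fx , v∈rest) with find (∈-concatMap⁻ f v∈rest)
  ... | y , y∈ , v∈fy = All.lookup x∉ y∈ (f#f (here refl) (there y∈) v∈fx v∈fy)

cartesianProductWith-unique : ∀ (f : A → B → C) {xs ys} →
  (∀ {w x y z} → w ∈ xs → x ∈ xs → y ∈ ys → z ∈ ys → f w y ≡ f x z → w ≡ x × y ≡ z) →
  Unique xs → Unique ys → Unique (cartesianProductWith f xs ys)
cartesianProductWith-unique f _ [] _ = []
cartesianProductWith-unique f {xs = x ∷ xs} {ys} inj (x∉ ∷ xs!) ys! =
  Unique.++⁺ (Unique-map⁺-on (f x) (λ p q → proj₂ ∘ inj (here refl) (here refl) p q) ys!)
    (cartesianProductWith-unique f (λ p q → inj (there p) (there q)) xs! ys!)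
    disjoint
  where
  disjoint : ∀ {v} → ¬ (v ∈ map (f x) ys × v ∈ cartesianProductWith f xs ys)
  disjoint (v∈row , v∈rest) with ∈-map⁻ (f x) v∈row | ∈-cartesianProductWith⁻ f xs ys v∈rest
  ... | c , c∈ , refl | a , b , a∈ , b∈ , eq =
    All.lookup x∉ a∈ (proj₁ (inj (here refl) (there a∈) c∈ b∈ eq))

length-cartesianProductWith : ∀ (f : A → B → C) xs ys →
  length (cartesianProductWith f xs ys) ≡ length xs * length ys
length-cartesianProductWith f []       ys = refl
length-cartesianProductWith f (x ∷ xs) ys = trans (List.length-++ (map (f x) ys))
  (cong₂ _+_ (List.length-map (f x) ys) (length-cartesianProductWith f xs ys))

Unique-∼set⇒length≡ : ∀ {xs ys : List A} → Unique xs → Unique ys → xs ∼[ set ] ys → length xs ≡ length ys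
Unique-∼set⇒length≡ xs! ys! xs∼ys = ↭-length (∼bag⇒↭ (unique∧set⇒bag xs! ys! xs∼ys))

Unique-⊆⇒length≤ : ∀ {xs ys : List A} → Unique xs → xs ⊆ ys → length xs ≤ length ys
Unique-⊆⇒length≤ []         _   = z≤n
Unique-⊆⇒length≤ {xs = x ∷ xs} (x∉ ∷ xs!) sub with ∈-∃++ (sub (here refl))
... | ws , zs , refl = begin
  suc (length xs)         ≤⟨ s≤s (Unique-⊆⇒length≤ xs! sub′) ⟩
  suc (length (ws ++ zs)) ≡⟨ List.length-++-sucʳ ws x zs ⟨
  length (ws ++ x ∷ zs)   ∎
  where
  open ≤-Reasoning
  sub′ : xs ⊆ ws ++ zs
  sub′ v∈ with ∈-++⁻ ws (sub (there v∈))
  ... | inj₁ v∈ws         = ∈-++⁺ˡ v∈ws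
  ... | inj₂ (here refl)  = ⊥-elim (All.lookup x∉ v∈ refl)
  ... | inj₂ (there v∈zs) = ∈-++⁺ʳ ws v∈zs

++-∷-first-unique : ∀ {P : A → Set} {ws ws′ x x′ zs zs′} → All (∁ P) ws → All (∁ P) ws′ → P x → P x′ →
                    ws ++ x ∷ zs ≡ ws′ ++ x′ ∷ zs′ → ws ≡ ws′ × x ∷ zs ≡ x′ ∷ zs′
++-∷-first-unique {ws = []}    {[]}     _         _          _  _   eq = refl , eq
++-∷-first-unique {ws = []}    {_ ∷ _}  _         (¬Pw′ ∷ _) Px _   refl = ⊥-elim (¬Pw′ Px)
++-∷-first-unique {ws = _ ∷ _} {[]}     (¬Pw ∷ _) _          _  Px′ refl = ⊥-elim (¬Pw Px′)
++-∷-first-unique {ws = w ∷ _} {_ ∷ _}  (_ ∷ ¬P)  (_ ∷ ¬P′)  Px Px′ eq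
  with refl , eq′ ← List.∷-injective eq =
  let ws≡ , rest≡ = ++-∷-first-unique ¬P ¬P′ Px Px′ eq′ in cong (w ∷_) ws≡ , rest≡

++-⊆-splitˡ : ∀ {P : A → Set} {as bs cs ds} → All P as → All (∁ P) ds → as ++ bs ⊆ cs ++ ds → as ⊆ cs
++-⊆-splitˡ {cs = cs} Pas ¬Pds sub v∈ with ∈-++⁻ cs (sub (∈-++⁺ˡ v∈))
... | inj₁ v∈cs = v∈cs
... | inj₂ v∈ds = ⊥-elim (All.lookup ¬Pds v∈ds (All.lookup Pas v∈))

++-⊆-splitʳ : ∀ {P : A → Set} {as bs cs ds} → All (∁ P) bs → All P cs → as ++ bs ⊆ cs ++ ds → bs ⊆ ds
++-⊆-splitʳ {as = as} {cs = cs} ¬Pbs Pcs sub v∈ with ∈-++⁻ cs (sub (∈-++⁺ʳ as v∈))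
... | inj₁ v∈cs = ⊥-elim (All.lookup ¬Pbs v∈ (All.lookup Pcs v∈cs))
... | inj₂ v∈ds = v∈ds

++-∼set-split : ∀ {P : A → Set} {as bs cs ds} → All P as → All P cs → All (∁ P) bs → All (∁ P) ds →
                as ++ bs ∼[ set ] cs ++ ds → as ∼[ set ] cs × bs ∼[ set ] ds
++-∼set-split Pas Pcs ¬Pbs ¬Pds eq =
  mk⇔ (++-⊆-splitˡ Pas ¬Pds (Equivalence.to eq)) (++-⊆-splitˡ Pcs ¬Pbs (Equivalence.from eq)) ,
  mk⇔ (++-⊆-splitʳ ¬Pbs Pcs (Equivalence.to eq)) (++-⊆-splitʳ ¬Pds Pas (Equivalence.from eq))

map-⊆⁻ : ∀ {f : A → B} {xs ys} → (∀ {a b} → f a ≡ f b → a ≡ b) → map f xs ⊆ map f ys → xs ⊆ ys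
map-⊆⁻ {f = f} inj sub v∈ with ∈-map⁻ f (sub (∈-map⁺ f v∈))
... | _ , w∈ , fv≡fw = subst (_∈ _) (sym (inj fv≡fw)) w∈

map-∼set⁻ : ∀ {f : A → B} {xs ys} → (∀ {a b} → f a ≡ f b → a ≡ b) →
            map f xs ∼[ set ] map f ys → xs ∼[ set ] ys
map-∼set⁻ inj eq = mk⇔ (map-⊆⁻ inj (Equivalence.to eq)) (map-⊆⁻ inj (Equivalence.from eq))

↭⇒∼set : ∀ {xs ys : List A} → xs ↭ ys → xs ∼[ set ] ys
↭⇒∼set xs↭ys = bag-=⇒ (↭⇒∼bag xs↭ys)

++-cancelˡ-↭ : ∀ (xs : List A) {ys zs} → xs ++ ys ↭ xs ++ zs → ys ↭ zs
++-cancelˡ-↭ []       ys↭zs  = ys↭zs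
++-cancelˡ-↭ (x ∷ xs) x∷xs↭ = ++-cancelˡ-↭ xs (drop-∷ x∷xs↭)

module _ {A : Set} where
  open Setoid ([ set ]-Equality A) public using () renaming (trans to ∼set-trans; sym to ∼set-sym)

-- Permutations of [1, N]

∈-insertEverywhere⁻ : ∀ x ys {σ} → σ ∈ insertEverywhere x ys → ∃₂ λ ws zs → σ ≡ ws ++ x ∷ zs × ys ≡ ws ++ zs
∈-insertEverywhere⁻ x []       (here refl) = [] , [] , refl , refl
∈-insertEverywhere⁻ x (y ∷ ys) (here refl) = [] , y ∷ ys , refl , refl
∈-insertEverywhere⁻ x (y ∷ ys) (there σ∈) with ∈-map⁻ (y ∷_) σ∈
... | σ′ , σ′∈ , refl with ∈-insertEverywhere⁻ x ys σ′∈
... | ws , zs , refl , refl = y ∷ ws , zs , refl , refl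

∈-insertEverywhere⁺ : ∀ x ws zs → ws ++ x ∷ zs ∈ insertEverywhere x (ws ++ zs)
∈-insertEverywhere⁺ x []       []       = here refl
∈-insertEverywhere⁺ x []       (z ∷ zs) = here refl
∈-insertEverywhere⁺ x (w ∷ ws) zs       = there (∈-map⁺ (w ∷_) (∈-insertEverywhere⁺ x ws zs))

insertEverywhere-unique : ∀ x ys → x ∉ ys → Unique (insertEverywhere x ys)
insertEverywhere-unique x []       _  = [] ∷ []
insertEverywhere-unique x (y ∷ ys) x∉ =
  All.tabulate fresh ∷ Unique.map⁺ List.∷-injectiveʳ (insertEverywhere-unique x ys (x∉ ∘ there))
  where
  fresh : ∀ {σ} → σ ∈ map (y ∷_) (insertEverywhere x ys) → ¬ x ∷ y ∷ ys ≡ σ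
  fresh σ∈ eq with ∈-map⁻ (y ∷_) σ∈
  ... | _ , _ , refl = x∉ (here (List.∷-injectiveˡ eq))

∈-perms⁻ : ∀ xs {σ} → σ ∈ perms xs → σ ↭ xs
∈-perms⁻ []       (here refl) = ↭-refl
∈-perms⁻ (x ∷ xs) σ∈ with find (∈-concatMap⁻ (insertEverywhere x) σ∈)
... | τ , τ∈ , σ∈τ with ∈-insertEverywhere⁻ x τ σ∈τ
... | ws , zs , refl , refl = ↭-trans (shift x ws zs) (prep x (∈-perms⁻ xs τ∈))

∈-perms⁺ : ∀ xs {σ} → σ ↭ xs → σ ∈ perms xs
∈-perms⁺ []       σ↭ with refl ← ↭-empty-inv σ↭ = here refl
∈-perms⁺ (x ∷ xs) σ↭ with ∈-∃++ (∈-resp-↭ (↭-sym σ↭) (here refl))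
... | ws , zs , refl = ∈-concatMap⁺ (insertEverywhere x)
  (lose (∈-perms⁺ xs (drop-mid ws [] σ↭)) (∈-insertEverywhere⁺ x ws zs))

perms-unique : ∀ {xs} → Unique xs → Unique (perms xs)
perms-unique []         = [] ∷ []
perms-unique {x ∷ xs} (x∉ ∷ xs!) =
  concatMap-unique (insertEverywhere x) (perms-unique xs!)
    (λ τ∈ → insertEverywhere-unique x _ (x∉τ τ∈)) same-insertion
  where
  x∉τ : ∀ {τ} → τ ∈ perms xs → x ∉ τ
  x∉τ τ∈ x∈ = All.lookup x∉ (∈-resp-↭ (∈-perms⁻ xs τ∈) x∈) refl
  avoids : ∀ ws {zs} → ws ++ zs ∈ perms xs → All (λ w → ¬ x ≡ w) ws
  avoids ws τ∈ = All.tabulate λ w∈ x≡w → x∉τ τ∈ (∈-++⁺ˡ (Any.map (λ {refl → x≡w}) w∈))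
  same-insertion : ∀ {a b σ} → a ∈ perms xs → b ∈ perms xs →
                   σ ∈ insertEverywhere x a → σ ∈ insertEverywhere x b → a ≡ b
  same-insertion a∈ b∈ σ∈a σ∈b
    with ∈-insertEverywhere⁻ x _ σ∈a | ∈-insertEverywhere⁻ x _ σ∈b
  ... | ws , zs , refl , refl | ws′ , zs′ , eq , refl
    with refl , refl ← ++-∷-first-unique {P = x ≡_} (avoids ws a∈) (avoids ws′ b∈) refl refl eq = refl

applyUpTo-+ : ∀ (f : ℕ → A) m n → applyUpTo f (m + n) ≡ applyUpTo f m ++ applyUpTo (f ∘ (m +_)) n
applyUpTo-+ f zero    n = refl
applyUpTo-+ f (suc m) n = cong (f 0 ∷_) (applyUpTo-+ (f ∘ suc) m n)

applyUpTo-cong : ∀ {f g : ℕ → A} n → (∀ i → f i ≡ g i) → applyUpTo f n ≡ applyUpTo g n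
applyUpTo-cong zero    f≗g = refl
applyUpTo-cong (suc n) f≗g = cong₂ _∷_ (f≗g 0) (applyUpTo-cong n (f≗g ∘ suc))

oneTo-+ : ∀ m n → oneTo (m + n) ≡ oneTo m ++ map (m +_) (oneTo n)
oneTo-+ m n = trans (applyUpTo-+ suc m n) (cong (oneTo m ++_)
  (trans (applyUpTo-cong n (λ i → sym (+-suc m i))) (sym (List.map-applyUpTo suc (m +_) n))))

∈-oneTo⁻ : ∀ {N x} → x ∈ oneTo N → 1 ≤ x × x ≤ N
∈-oneTo⁻ x∈ with ∈-applyUpTo⁻ suc x∈
... | _ , i<N , refl = s≤s z≤n , i<N

oneTo-unique : ∀ N → Unique (oneTo N)
oneTo-unique N = Unique.applyUpTo⁺₁ suc N (λ i<j _ → <⇒≢ i<j ∘ suc-injective)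

∈-oneTo-↭ : ∀ {N σ x} → σ ↭ oneTo N → x ∈ σ → 1 ≤ x × x ≤ N
∈-oneTo-↭ σ↭ = ∈-oneTo⁻ ∘ ∈-resp-↭ σ↭

∈ᵇ⇔∈ : ∀ {x ys} → T (x ∈ᵇ ys) ⇔ x ∈ ys
∈ᵇ⇔∈ {x} {ys} = mk⇔ (Any.map (≡ᵇ⇒≡ x _) ∘ any⁻ _ ys) (any⁺ _ ∘ Any.map (≡⇒≡ᵇ x _))

all-∈ᵇ⇔⊆ : ∀ {xs ys} → T (all (_∈ᵇ ys) xs) ⇔ xs ⊆ ys
all-∈ᵇ⇔⊆ {xs} {ys} = mk⇔ to from
  where
  to : T (all (_∈ᵇ ys) xs) → xs ⊆ ys
  to t v∈ = Equivalence.to ∈ᵇ⇔∈ (All.lookup (All.all⁺ _ xs t) v∈)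
  from : xs ⊆ ys → T (all (_∈ᵇ ys) xs)
  from xs⊆ = All.all⁻ _ (All.tabulate λ v∈ → Equivalence.from ∈ᵇ⇔∈ (xs⊆ v∈))

sameSet⇒∼set : ∀ {xs ys} → T (sameSet xs ys) → xs ∼[ set ] ys
sameSet⇒∼set t = let xs⊆ , ys⊆ = Equivalence.to T-∧ t in
  mk⇔ (Equivalence.to all-∈ᵇ⇔⊆ xs⊆) (Equivalence.to all-∈ᵇ⇔⊆ ys⊆)

∼set⇒sameSet : ∀ {xs ys} → xs ∼[ set ] ys → T (sameSet xs ys)
∼set⇒sameSet xs∼ys = Equivalence.from T-∧ ( Equivalence.from all-∈ᵇ⇔⊆ (Equivalence.to xs∼ys)
                                          , Equivalence.from all-∈ᵇ⇔⊆ (Equivalence.from xs∼ys))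

withPinnacleSet : ℕ → List ℕ → List (List ℕ)
withPinnacleSet N s = filterᵇ (λ σ → sameSet (pinnacles σ) s) (perms (oneTo N))

∈-withPinnacleSet⁻ : ∀ {N s σ} → σ ∈ withPinnacleSet N s → σ ↭ oneTo N × pinnacles σ ∼[ set ] s
∈-withPinnacleSet⁻ σ∈ = let σ∈perms , t = ∈-filter⁻ (T? ∘ _) σ∈ in ∈-perms⁻ _ σ∈perms , sameSet⇒∼set t

∈-withPinnacleSet⁺ : ∀ {N s σ} → σ ↭ oneTo N → pinnacles σ ∼[ set ] s → σ ∈ withPinnacleSet N s
∈-withPinnacleSet⁺ σ↭ σ∼s = ∈-filter⁺ (T? ∘ _) (∈-perms⁺ _ σ↭) (∼set⇒sameSet σ∼s)

withPinnacleSet-unique : ∀ N s → Unique (withPinnacleSet N s)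
withPinnacleSet-unique N s = Unique.filter⁺ _ (perms-unique (oneTo-unique N))

-- Labels of internal nodes

m+n+o+1≡m+[n+o+1] : ∀ m n o → m + n + o + 1 ≡ m + (n + o + 1)
m+n+o+1≡m+[n+o+1] = solve-∀

internalsT-shift : ∀ a k t → internalsT (a + k) t ≡ map (a +_) (internalsT k t)
internalsT-shift a k leaf       = refl
internalsT-shift a k (node l r) = begin
  internalsT (a + k) l ++ internalsT (a + k + size l) r ++ [ a + k + size l + size r + 1 ]
    ≡⟨ cong (λ m → internalsT (a + k) l ++ internalsT m r ++ [ m + size r + 1 ]) (+-assoc a k (size l)) ⟩
  internalsT (a + k) l ++ internalsT (a + (k + size l)) r ++ [ a + (k + size l) + size r + 1 ]
    ≡⟨ cong₂ _++_ (internalsT-shift a k l)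
         (cong₂ _++_ (internalsT-shift a (k + size l) r) (cong [_] (m+n+o+1≡m+[n+o+1] a (k + size l) (size r)))) ⟩
  map (a +_) (internalsT k l) ++ map (a +_) (internalsT (k + size l) r) ++ map (a +_) [ k + size l + size r + 1 ]
    ≡⟨ cong (map (a +_) (internalsT k l) ++_) (List.map-++ (a +_) (internalsT (k + size l) r) _) ⟨
  map (a +_) (internalsT k l) ++ map (a +_) (internalsT (k + size l) r ++ [ k + size l + size r + 1 ])
    ≡⟨ List.map-++ (a +_) (internalsT k l) _ ⟨
  map (a +_) (internalsT k (node l r)) ∎
  where open ≡-Reasoning

internalsF-shift : ∀ a k ts → internalsF (a + k) ts ≡ map (a +_) (internalsF k ts)
internalsF-shift a k []       = refl
internalsF-shift a k (t ∷ ts) = trans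
  (cong₂ _++_ (internalsT-shift a k t)
              (trans (cong (λ m → internalsF m ts) (+-assoc a k (size t))) (internalsF-shift a (k + size t) ts)))
  (sym (List.map-++ (a +_) (internalsT k t) _))

internalsT-bounds : ∀ k t {x} → x ∈ internalsT k t → k < x × x ≤ k + size t
internalsT-bounds k (node l r) {x} x∈ with ∈-++⁻ (internalsT k l) x∈
... | inj₁ x∈l = let k<x , x≤ = internalsT-bounds k l x∈l in
  k<x , ≤-trans x≤ (+-monoʳ-≤ k (≤-trans (m≤m+n (size l) (size r)) (m≤m+n _ 1)))
... | inj₂ x∈ with ∈-++⁻ (internalsT (k + size l) r) x∈
... | inj₁ x∈r = let k+l<x , x≤ = internalsT-bounds (k + size l) r x∈r in
  ≤-<-trans (m≤m+n k (size l)) k+l<x , ≤-trans x≤ (≤-trans (m≤m+n _ 1) root≤)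
  where
  root≤ : k + size l + size r + 1 ≤ k + size (node l r)
  root≤ = ≤-reflexive (m+n+o+1≡m+[n+o+1] k (size l) (size r))
... | inj₂ (here refl) = ≤-<-trans (≤-trans (m≤m+n k (size l)) (m≤m+n _ (size r))) (m<m+n _ z<s) ,
                         ≤-reflexive (m+n+o+1≡m+[n+o+1] k (size l) (size r))

internalsF-lowerBound : ∀ k ts {x} → x ∈ internalsF k ts → k < x
internalsF-lowerBound k (t ∷ ts) x∈ with ∈-++⁻ (internalsT k t) x∈
... | inj₁ x∈t  = proj₁ (internalsT-bounds k t x∈t)
... | inj₂ x∈ts = ≤-<-trans (m≤m+n k (size t)) (internalsF-lowerBound (k + size t) ts x∈ts)

internalsT-unique : ∀ k t → Unique (internalsT k t)
internalsT-unique k leaf       = []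
internalsT-unique k (node l r) =
  Unique.++⁺ (internalsT-unique k l)
    (Unique.++⁺ (internalsT-unique (k + size l) r) ([] ∷ []) right#root)
    left#rest
  where
  root : ℕ
  root = k + size l + size r + 1
  below-root : ∀ {x} → x ≤ k + size l + size r → x < root
  below-root x≤ = ≤-<-trans x≤ (m<m+n _ z<s)
  right#root : ∀ {x} → ¬ (x ∈ internalsT (k + size l) r × x ∈ [ root ])
  right#root (x∈r , here refl) = <-irrefl refl (below-root (proj₂ (internalsT-bounds (k + size l) r x∈r)))
  left#rest : ∀ {x} → ¬ (x ∈ internalsT k l × x ∈ internalsT (k + size l) r ++ [ root ])
  left#rest (x∈l , x∈) with proj₂ (internalsT-bounds k l x∈l) | ∈-++⁻ (internalsT (k + size l) r) x∈
  ... | x≤ | inj₁ x∈r        = <⇒≱ (proj₁ (internalsT-bounds (k + size l) r x∈r)) x≤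
  ... | x≤ | inj₂ (here refl) = <-irrefl refl (below-root (≤-trans x≤ (m≤m+n _ (size r))))

internalsT-length : ∀ k t → length (internalsT k t) + length (internalsT k t) + 1 ≡ size t
internalsT-length k leaf       = refl
internalsT-length k (node l r) = begin
  length (internalsT k (node l r)) + length (internalsT k (node l r)) + 1
    ≡⟨ cong (λ m → m + m + 1) (trans (List.length-++ (internalsT k l))
                                  (cong (a +_) (List.length-++ (internalsT (k + size l) r)))) ⟩
  (a + (b + 1)) + (a + (b + 1)) + 1 ≡⟨ regroup a b ⟩
  (a + a + 1) + (b + b + 1) + 1     ≡⟨ cong₂ (λ x y → x + y + 1) (internalsT-length k l) (internalsT-length (k + size l) r) ⟩
  size (node l r)                   ∎
  where
  open ≡-Reasoning
  a b : ℕ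
  a = length (internalsT k l)
  b = length (internalsT (k + size l) r)
  regroup : ∀ a b → (a + (b + 1)) + (a + (b + 1)) + 1 ≡ (a + a + 1) + (b + b + 1) + 1
  regroup = solve-∀

-- Pinnacles

<ᵇ-true : ∀ {a b} → a < b → (a <ᵇ b) ≡ true
<ᵇ-true a<b = Equivalence.to T-≡ (<⇒<ᵇ a<b)

<ᵇ-false : ∀ {a b} → b ≤ a → (a <ᵇ b) ≡ false
<ᵇ-false {a} {b} b≤a with a <ᵇ b in eq
... | false = refl
... | true  = ⊥-elim (<⇒≱ (<ᵇ⇒< a b (Equivalence.from T-≡ eq)) b≤a)

headPinnacle : ℕ → List ℕ → List ℕ
headPinnacle a (b ∷ c ∷ _) = if (a <ᵇ b) ∧ (c <ᵇ b) then [ b ] else []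
headPinnacle a _           = []

pinnacles-∷ : ∀ a L → pinnacles (a ∷ L) ≡ headPinnacle a L ++ pinnacles L
pinnacles-∷ a []          = refl
pinnacles-∷ a (b ∷ [])    = refl
pinnacles-∷ a (b ∷ c ∷ L) = refl

∈-headPinnacle⁻ : ∀ a L {v} → v ∈ headPinnacle a L → v ∈ L × a < v
∈-headPinnacle⁻ a (b ∷ c ∷ L) v∈ with a <ᵇ b in a<b | c <ᵇ b
∈-headPinnacle⁻ a (b ∷ c ∷ L) (here refl) | true | true = here refl , <ᵇ⇒< a b (Equivalence.from T-≡ a<b)

∈-pinnacles⁻ : ∀ σ {v} → v ∈ pinnacles σ → v ∈ σ × ∃ λ c → c ∈ σ × c < v
∈-pinnacles⁻ (a ∷ L) {v} v∈ with ∈-++⁻ (headPinnacle a L) (subst (v ∈_) (pinnacles-∷ a L) v∈)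
... | inj₁ v∈head = let v∈L , a<v = ∈-headPinnacle⁻ a L v∈head in there v∈L , a , here refl , a<v
... | inj₂ v∈rest = let v∈L , c , c∈L , c<v = ∈-pinnacles⁻ L v∈rest in there v∈L , c , there c∈L , c<v

All-pinnacles : ∀ {P : ℕ → Set} {σ} → All P σ → All P (pinnacles σ)
All-pinnacles {σ = σ} Pσ = All.tabulate (All.lookup Pσ ∘ proj₁ ∘ ∈-pinnacles⁻ σ)

pinnacles-above : ∀ {m σ} → All (m ≤_) σ → All (suc m ≤_) (pinnacles σ)
pinnacles-above {σ = σ} σ≥m = All.tabulate λ v∈ →
  let _ , c , c∈ , c<v = ∈-pinnacles⁻ σ v∈ in ≤-trans (s≤s (All.lookup σ≥m c∈)) c<v

<ᵇ-+ : ∀ k a b → (k + a <ᵇ k + b) ≡ (a <ᵇ b)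
<ᵇ-+ zero    a b = refl
<ᵇ-+ (suc k) a b = <ᵇ-+ k a b

headPinnacle-map-+ : ∀ k a L → headPinnacle (k + a) (map (k +_) L) ≡ map (k +_) (headPinnacle a L)
headPinnacle-map-+ k a []          = refl
headPinnacle-map-+ k a (b ∷ [])    = refl
headPinnacle-map-+ k a (b ∷ c ∷ L) rewrite <ᵇ-+ k a b | <ᵇ-+ k c b with (a <ᵇ b) ∧ (c <ᵇ b)
... | true  = refl
... | false = refl

pinnacles-map-+ : ∀ k σ → pinnacles (map (k +_) σ) ≡ map (k +_) (pinnacles σ)
pinnacles-map-+ k []      = refl
pinnacles-map-+ k (a ∷ L) = begin
  pinnacles (k + a ∷ map (k +_) L)                                 ≡⟨ pinnacles-∷ (k + a) (map (k +_) L) ⟩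
  headPinnacle (k + a) (map (k +_) L) ++ pinnacles (map (k +_) L)  ≡⟨ cong₂ _++_ (headPinnacle-map-+ k a L) (pinnacles-map-+ k L) ⟩
  map (k +_) (headPinnacle a L) ++ map (k +_) (pinnacles L)        ≡⟨ List.map-++ (k +_) (headPinnacle a L) _ ⟨
  map (k +_) (headPinnacle a L ++ pinnacles L)                     ≡⟨ cong (map (k +_)) (pinnacles-∷ a L) ⟨
  map (k +_) (pinnacles (a ∷ L))                                   ∎
  where open ≡-Reasoning

headPinnacle-descent : ∀ {a x} L → x < a → headPinnacle a (x ∷ L) ≡ []
headPinnacle-descent []      x<a = refl
headPinnacle-descent (_ ∷ _) x<a rewrite <ᵇ-false (<⇒≤ x<a) = refl

headPinnacle-ascent : ∀ a {b c} L → b < c → headPinnacle a (b ∷ c ∷ L) ≡ []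
headPinnacle-ascent a {b} L b<c rewrite <ᵇ-false (<⇒≤ b<c) | ∧-zeroʳ (a <ᵇ b) = refl

headPinnacle-leftBelow : ∀ {a a′ b} L → a < b → a′ < b → headPinnacle a (b ∷ L) ≡ headPinnacle a′ (b ∷ L)
headPinnacle-leftBelow []      a<b a′<b = refl
headPinnacle-leftBelow (_ ∷ _) a<b a′<b rewrite <ᵇ-true a<b | <ᵇ-true a′<b = refl

headPinnacle-rightBelow : ∀ a {b x x′} L L′ → x < b → x′ < b →
                          headPinnacle a (b ∷ x ∷ L) ≡ headPinnacle a (b ∷ x′ ∷ L′)
headPinnacle-rightBelow a L L′ x<b x′<b rewrite <ᵇ-true x<b | <ᵇ-true x′<b = refl

module _ {n : ℕ} where

  headPinnacle-block : ∀ {a x c} α L L′ → n < a → All (n <_) α → x ≤ n → c ≤ n →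
                       headPinnacle a (α ++ x ∷ L) ≡ headPinnacle a (α ++ c ∷ L′)
  headPinnacle-block []          L L′ n<a _          x≤n c≤n =
    trans (headPinnacle-descent L (≤-<-trans x≤n n<a)) (sym (headPinnacle-descent L′ (≤-<-trans c≤n n<a)))
  headPinnacle-block (b ∷ [])    L L′ n<a (n<b ∷ _)  x≤n c≤n =
    headPinnacle-rightBelow _ L L′ (≤-<-trans x≤n n<b) (≤-<-trans c≤n n<b)
  headPinnacle-block (_ ∷ _ ∷ _) L L′ n<a _          x≤n c≤n = refl

  headPinnacle-++-large : ∀ a {y} u β → y ≤ n → All (n <_) β → headPinnacle a (y ∷ u ++ β) ≡ headPinnacle a (y ∷ u)
  headPinnacle-++-large a []      []      y≤n _         = refl
  headPinnacle-++-large a []      (_ ∷ β) y≤n (n<b ∷ _) = headPinnacle-ascent a β (≤-<-trans y≤n n<b)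
  headPinnacle-++-large a (_ ∷ _) β       y≤n _         = refl

  pinnacles-small-++-large : ∀ {x c} u β → x ≤ n → All (_≤ n) u → All (n <_) β → c ≤ n →
                             pinnacles (x ∷ u ++ β) ≡ pinnacles (x ∷ u) ++ pinnacles (c ∷ β)
  pinnacles-small-++-large         []      []      x≤n _          _         c≤n = refl
  pinnacles-small-++-large {x} {c} []      (b ∷ β) x≤n _          (n<b ∷ _) c≤n = begin
    pinnacles (x ∷ b ∷ β)                       ≡⟨ pinnacles-∷ x (b ∷ β) ⟩
    headPinnacle x (b ∷ β) ++ pinnacles (b ∷ β) ≡⟨ cong (_++ pinnacles (b ∷ β))
                                                      (headPinnacle-leftBelow β (≤-<-trans x≤n n<b) (≤-<-trans c≤n n<b)) ⟩
    headPinnacle c (b ∷ β) ++ pinnacles (b ∷ β) ≡⟨ pinnacles-∷ c (b ∷ β) ⟨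
    pinnacles (c ∷ b ∷ β)                       ∎
    where open ≡-Reasoning
  pinnacles-small-++-large {x} {c} (y ∷ u) β       x≤n (y≤n ∷ u≤n) β>n       c≤n = begin
    pinnacles (x ∷ y ∷ u ++ β)
      ≡⟨ pinnacles-∷ x (y ∷ u ++ β) ⟩
    headPinnacle x (y ∷ u ++ β) ++ pinnacles (y ∷ u ++ β)
      ≡⟨ cong₂ _++_ (headPinnacle-++-large x u β y≤n β>n) (pinnacles-small-++-large u β y≤n u≤n β>n c≤n) ⟩
    headPinnacle x (y ∷ u) ++ pinnacles (y ∷ u) ++ pinnacles (c ∷ β)
      ≡⟨ List.++-assoc (headPinnacle x (y ∷ u)) _ _ ⟨
    (headPinnacle x (y ∷ u) ++ pinnacles (y ∷ u)) ++ pinnacles (c ∷ β)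
      ≡⟨ cong (_++ pinnacles (c ∷ β)) (pinnacles-∷ x (y ∷ u)) ⟨
    pinnacles (x ∷ y ∷ u) ++ pinnacles (c ∷ β) ∎
    where open ≡-Reasoning

  pinnacles-block : ∀ {x c} α u β → All (n <_) α → x ≤ n → All (_≤ n) u → All (n <_) β → c ≤ n →
                    pinnacles (α ++ x ∷ u ++ β) ↭ pinnacles (x ∷ u) ++ pinnacles (α ++ c ∷ β)
  pinnacles-block []      u β _ x≤n u≤n β>n c≤n = ↭-reflexive (pinnacles-small-++-large u β x≤n u≤n β>n c≤n)
  pinnacles-block {x} {c} (a ∷ α) u β (n<a ∷ α>n) x≤n u≤n β>n c≤n = begin
    pinnacles (a ∷ α ++ x ∷ u ++ β)
      ≡⟨ pinnacles-∷ a (α ++ x ∷ u ++ β) ⟩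
    headPinnacle a (α ++ x ∷ u ++ β) ++ pinnacles (α ++ x ∷ u ++ β)
      ≡⟨ cong (_++ pinnacles (α ++ x ∷ u ++ β)) (headPinnacle-block α (u ++ β) β n<a α>n x≤n c≤n) ⟩
    headPinnacle a (α ++ c ∷ β) ++ pinnacles (α ++ x ∷ u ++ β)
      ↭⟨ ++⁺ˡ (headPinnacle a (α ++ c ∷ β)) (pinnacles-block α u β α>n x≤n u≤n β>n c≤n) ⟩
    headPinnacle a (α ++ c ∷ β) ++ pinnacles (x ∷ u) ++ pinnacles (α ++ c ∷ β)
      ↭⟨ shifts (headPinnacle a (α ++ c ∷ β)) (pinnacles (x ∷ u)) ⟩
    pinnacles (x ∷ u) ++ headPinnacle a (α ++ c ∷ β) ++ pinnacles (α ++ c ∷ β)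
      ≡⟨ cong (pinnacles (x ∷ u) ++_) (pinnacles-∷ a (α ++ c ∷ β)) ⟨
    pinnacles (x ∷ u) ++ pinnacles (a ∷ α ++ c ∷ β) ∎
    where open PermutationReasoning

-- Runs of small entries

≤ᵇ-sound : ∀ {a b} → (a ≤ᵇ b) ≡ true → a ≤ b
≤ᵇ-sound {a} {b} a≤b = ≤ᵇ⇒≤ a b (Equivalence.from T-≡ a≤b)

≤ᵇ-false⇒> : ∀ {a b} → (a ≤ᵇ b) ≡ false → b < a
≤ᵇ-false⇒> a≰b = ≰⇒> (λ a≤b → subst T a≰b (≤⇒≤ᵇ a≤b))

≤ᵇ-false : ∀ {a b} → b < a → (a ≤ᵇ b) ≡ false
≤ᵇ-false {a} {b} b<a with a ≤ᵇ b in a≤b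
... | false = refl
... | true  = ⊥-elim (<⇒≱ b<a (≤ᵇ-sound a≤b))

indicator : Bool → ℕ
indicator true  = 1
indicator false = 0

indicator≤1 : ∀ b → indicator b ≤ 1
indicator≤1 true  = s≤s z≤n
indicator≤1 false = z≤n

local-budget : ∀ sx sy xy zy yx → (T xy → T sy → T sx) → (T yx → T sx → T sy) → (T xy → T yx → ⊥) →
  indicator (sy ∧ xy ∧ zy) + indicator (sy ∧ xy ∧ zy) + indicator (sx ∧ not sy) + indicator (sx ∧ yx)
    ≤ indicator sx + indicator (sy ∧ zy)
local-budget false false _     _     _     _ _ _ = z≤n
local-budget false true  true  _     _     p _ _ = ⊥-elim (p _ _)
local-budget false true  false _     _     _ _ _ = z≤n
local-budget true  false _     _     true  _ q _ = ⊥-elim (q _ _)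
local-budget true  false _     _     false _ _ _ = s≤s z≤n
local-budget true  true  true  _     true  _ _ r = ⊥-elim (r _ _)
local-budget true  true  true  true  false _ _ _ = ≤-refl
local-budget true  true  true  false false _ _ _ = z≤n
local-budget true  true  false _     yx    _ _ _ = ≤-trans (indicator≤1 yx) (s≤s z≤n)

module SmallRuns (n : ℕ) where

  small : ℕ → Bool
  small x = x ≤ᵇ n

  smallCount : List ℕ → ℕ
  smallCount σ = length (filter (_≤? n) σ)

  startsSmall : List ℕ → Bool
  startsSmall []      = false
  startsSmall (y ∷ _) = small y

  -- the number of maximal runs of small entries, each counted at its last entry
  runCount : List ℕ → ℕ
  runCount []      = 0
  runCount (x ∷ σ) = indicator (small x ∧ not (startsSmall σ)) + runCount σ

  startsBelow : ℕ → List ℕ → Bool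
  startsBelow y []      = false
  startsBelow y (z ∷ _) = z <ᵇ y

  descentBonus : List ℕ → ℕ
  descentBonus []      = 0
  descentBonus (y ∷ t) = indicator (small y ∧ startsBelow y t)

  smallCount-∷ : ∀ x σ → smallCount (x ∷ σ) ≡ indicator (small x) + smallCount σ
  smallCount-∷ x σ with x ≤ᵇ n
  ... | true  = refl
  ... | false = refl

  smallCount-++ : ∀ σ τ → smallCount (σ ++ τ) ≡ smallCount σ + smallCount τ
  smallCount-++ σ τ = trans (cong length (List.filter-++ (_≤? n) σ τ)) (List.length-++ (filter (_≤? n) σ))

  headPinnacle-smallCount : ∀ x y t →
    smallCount (headPinnacle x (y ∷ t)) ≡ indicator (small y ∧ (x <ᵇ y) ∧ startsBelow y t)
  headPinnacle-smallCount x y [] with y ≤ᵇ n | x <ᵇ y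
  ... | true  | true  = refl
  ... | true  | false = refl
  ... | false | _     = refl
  headPinnacle-smallCount x y (z ∷ t) with (x <ᵇ y) ∧ (z <ᵇ y)
  ... | true  with y ≤ᵇ n
  ...   | true  = refl
  ...   | false = refl
  headPinnacle-smallCount x y (z ∷ t) | false with y ≤ᵇ n
  ...   | true  = refl
  ...   | false = refl

  head-budget : ∀ x y t →
    smallCount (headPinnacle x (y ∷ t)) + smallCount (headPinnacle x (y ∷ t))
      + indicator (small x ∧ not (small y)) + indicator (small x ∧ (y <ᵇ x))
    ≤ indicator (small x) + descentBonus (y ∷ t)
  head-budget x y t = subst (λ h → h + h + indicator (small x ∧ not (small y)) + indicator (small x ∧ (y <ᵇ x))
                                       ≤ indicator (small x) + descentBonus (y ∷ t))
                            (sym (headPinnacle-smallCount x y t))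
    (local-budget (small x) (small y) (x <ᵇ y) (startsBelow y t) (y <ᵇ x) (below-small {x} {y}) (below-small {y} {x})
      (λ x<y y<x → <-asym (<ᵇ⇒< x y x<y) (<ᵇ⇒< y x y<x)))
    where
    below-small : ∀ {a b} → T (a <ᵇ b) → T (small b) → T (small a)
    below-small {a} {b} a<b b≤n = ≤⇒≤ᵇ (<⇒≤ (<-≤-trans (<ᵇ⇒< a b a<b) (≤ᵇ⇒≤ b n b≤n)))

  -- The descent bonus of y ∷ z ∷ … (y small, z < y) pays for y becoming a pinnacle once some x < y is
  -- put in front of it.
  pinnacle-budget : ∀ σ → smallCount (pinnacles σ) + smallCount (pinnacles σ) + runCount σ + descentBonus σ
                          ≤ smallCount σ
  pinnacle-budget []          = z≤n
  pinnacle-budget (x ∷ [])    with x ≤ᵇ n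
  ... | true  = s≤s z≤n
  ... | false = z≤n
  pinnacle-budget (x ∷ y ∷ t) = begin
    P′ + P′ + (i₁ + R) + i₂           ≡⟨ cong (λ p → p + p + (i₁ + R) + i₂)
                                           (trans (cong smallCount (pinnacles-∷ x (y ∷ t)))
                                                  (smallCount-++ (headPinnacle x (y ∷ t)) _)) ⟩
    (h + P) + (h + P) + (i₁ + R) + i₂ ≡⟨ regroup₁ h P i₁ R i₂ ⟩
    (h + h + i₁ + i₂) + (P + P + R)   ≤⟨ +-monoˡ-≤ (P + P + R) (head-budget x y t) ⟩
    (ix + D) + (P + P + R)            ≡⟨ regroup₂ ix D P R ⟩
    ix + (P + P + R + D)              ≤⟨ +-monoʳ-≤ ix (pinnacle-budget (y ∷ t)) ⟩
    ix + smallCount (y ∷ t)           ≡⟨ smallCount-∷ x (y ∷ t) ⟨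
    smallCount (x ∷ y ∷ t)            ∎
    where
    open ≤-Reasoning
    P′ h P R D i₁ i₂ ix : ℕ
    P′ = smallCount (pinnacles (x ∷ y ∷ t))
    h  = smallCount (headPinnacle x (y ∷ t))
    P  = smallCount (pinnacles (y ∷ t))
    R  = runCount (y ∷ t)
    D  = descentBonus (y ∷ t)
    i₁ = indicator (small x ∧ not (small y))
    i₂ = indicator (small x ∧ (y <ᵇ x))
    ix = indicator (small x)
    regroup₁ : ∀ h P i₁ R i₂ → (h + P) + (h + P) + (i₁ + R) + i₂ ≡ (h + h + i₁ + i₂) + (P + P + R)
    regroup₁ = solve-∀
    regroup₂ : ∀ ix D P R → (ix + D) + (P + P + R) ≡ ix + (P + P + R + D)
    regroup₂ = solve-∀

  startsSmall-large : ∀ {t} → All (n <_) t → startsSmall t ≡ false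
  startsSmall-large []          = refl
  startsSmall-large (n<y ∷ _)   = ≤ᵇ-false n<y

  runCount≡0⇒large : ∀ σ → runCount σ ≡ 0 → All (n <_) σ
  runCount≡0⇒large []      _  = []
  runCount≡0⇒large (x ∷ t) eq
    with t-large ← runCount≡0⇒large t (m+n≡0⇒n≡0 (indicator (small x ∧ not (startsSmall t))) eq)
    with x ≤ᵇ n in sx
  ... | false = ≤ᵇ-false⇒> sx ∷ t-large
  ... | true  = ⊥-elim (1+n≢0 (subst (λ b → indicator (not b) + runCount t ≡ 0) (startsSmall-large t-large) eq))

  record SmallBlock (σ : List ℕ) : Set where
    field
      before block after : List ℕ
      split        : σ ≡ before ++ block ++ after
      before-large : All (n <_) before
      block-small  : All (_≤ n) block
      after-large  : All (n <_) after

  small-prefix : ∀ t → indicator (not (startsSmall t)) + runCount t ≤ 1 →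
                 ∃₂ λ u β → t ≡ u ++ β × All (_≤ n) u × All (n <_) β
  small-prefix []      _     = [] , [] , refl , [] , []
  small-prefix (y ∷ t) bound with y ≤ᵇ n in sy
  ... | false = [] , y ∷ t , refl , [] , ≤ᵇ-false⇒> sy ∷ runCount≡0⇒large t (n≤0⇒n≡0 (≤-pred bound))
  ... | true  = let u , β , t≡ , u-small , β-large = small-prefix t bound in
                y ∷ u , β , cong (y ∷_) t≡ , ≤ᵇ-sound sy ∷ u-small , β-large

  runCount≤1⇒block : ∀ σ → runCount σ ≤ 1 → SmallBlock σ
  runCount≤1⇒block []      _     = record { before = [] ; block = [] ; after = [] ; split = refl
                                          ; before-large = [] ; block-small = [] ; after-large = [] }
  runCount≤1⇒block (x ∷ t) bound with x ≤ᵇ n in sx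
  ... | false = let open SmallBlock (runCount≤1⇒block t bound) in
                record { before = x ∷ before ; block = block ; after = after ; split = cong (x ∷_) split
                       ; before-large = ≤ᵇ-false⇒> sx ∷ before-large ; block-small = block-small ; after-large = after-large }
  ... | true  = let u , β , t≡ , u-small , β-large = small-prefix t bound in
                record { before = [] ; block = x ∷ u ; after = β ; split = cong (x ∷_) t≡
                       ; before-large = [] ; block-small = ≤ᵇ-sound sx ∷ u-small ; after-large = β-large }

  runCount≤1 : ∀ σ L → L ≤ smallCount (pinnacles σ) → smallCount σ ≡ L + L + 1 → runCount σ ≤ 1
  runCount≤1 σ L L≤P count = +-cancelˡ-≤ (L + L) (runCount σ) 1 (begin
    L + L + runCount σ                    ≤⟨ +-monoˡ-≤ (runCount σ) (+-mono-≤ L≤P L≤P) ⟩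
    P + P + runCount σ                    ≤⟨ m≤m+n _ (descentBonus σ) ⟩
    P + P + runCount σ + descentBonus σ   ≤⟨ pinnacle-budget σ ⟩
    smallCount σ                          ≡⟨ count ⟩
    L + L + 1                             ∎)
    where
    open ≤-Reasoning
    P : ℕ
    P = smallCount (pinnacles σ)

  filter-block : ∀ α u β → All (n <_) α → All (_≤ n) u → All (n <_) β → filter (_≤? n) (α ++ u ++ β) ≡ u
  filter-block α u β α-large u-small β-large = begin
    filter (_≤? n) (α ++ u ++ β)                 ≡⟨ List.filter-++ (_≤? n) α (u ++ β) ⟩
    filter (_≤? n) α ++ filter (_≤? n) (u ++ β)  ≡⟨ cong₂ _++_ (List.filter-none (_≤? n) (All.map <⇒≱ α-large))
                                                                (List.filter-++ (_≤? n) u β) ⟩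
    filter (_≤? n) u ++ filter (_≤? n) β         ≡⟨ cong₂ _++_ (List.filter-all (_≤? n) u-small)
                                                                (List.filter-none (_≤? n) (All.map <⇒≱ β-large)) ⟩
    u ++ []                                      ≡⟨ List.++-identityʳ u ⟩
    u                                            ∎
    where open ≡-Reasoning

-- Gluing

glue : ℕ → List ℕ → List ℕ → List ℕ
glue k τ u = concatMap (λ x → if x ≡ᵇ 1 then u else [ k + x ]) τ

glue-split : ∀ k u α β → All (2 ≤_) α → All (2 ≤_) β → glue k (α ++ 1 ∷ β) u ≡ map (k +_) α ++ u ++ map (k +_) β
glue-split k u α β α≥2 β≥2 = begin
  glue k (α ++ 1 ∷ β) u                 ≡⟨ List.concatMap-++ _ α (1 ∷ β) ⟩
  glue k α u ++ u ++ glue k β u         ≡⟨ cong₂ (λ l r → l ++ u ++ r) (glue-shift α α≥2) (glue-shift β β≥2) ⟩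
  map (k +_) α ++ u ++ map (k +_) β     ∎
  where
  open ≡-Reasoning
  glue-shift : ∀ γ → All (2 ≤_) γ → glue k γ u ≡ map (k +_) γ
  glue-shift []                  _                   = refl
  glue-shift (suc (suc a) ∷ γ) (s≤s (s≤s _) ∷ γ≥2) = cong (k + suc (suc a) ∷_) (glue-shift γ γ≥2)

shift-large : ∀ k γ → All (2 ≤_) γ → All (suc k <_) (map (k +_) γ)
shift-large k γ γ≥2 = All.map⁺ (All.map (λ {a} 2≤a → subst (_≤ k + a) (+-comm k 2) (+-monoʳ-≤ k 2≤a)) γ≥2)

pinnacles-glue : ∀ k {x} u α β → All (2 ≤_) α → All (2 ≤_) β → All (_≤ suc k) (x ∷ u) →
                 pinnacles (glue k (α ++ 1 ∷ β) (x ∷ u)) ↭ pinnacles (x ∷ u) ++ map (k +_) (pinnacles (α ++ 1 ∷ β))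
pinnacles-glue k {x} u α β α≥2 β≥2 (x≤n ∷ u≤n) = begin
  pinnacles (glue k (α ++ 1 ∷ β) (x ∷ u))
    ≡⟨ cong pinnacles (glue-split k (x ∷ u) α β α≥2 β≥2) ⟩
  pinnacles (map (k +_) α ++ x ∷ u ++ map (k +_) β)
    ↭⟨ pinnacles-block (map (k +_) α) u (map (k +_) β) (shift-large k α α≥2) x≤n u≤n (shift-large k β β≥2) k+1≤n ⟩
  pinnacles (x ∷ u) ++ pinnacles (map (k +_) α ++ k + 1 ∷ map (k +_) β)
    ≡⟨ cong (λ l → pinnacles (x ∷ u) ++ pinnacles l) (List.map-++ (k +_) α (1 ∷ β)) ⟨
  pinnacles (x ∷ u) ++ pinnacles (map (k +_) (α ++ 1 ∷ β))
    ≡⟨ cong (pinnacles (x ∷ u) ++_) (pinnacles-map-+ k (α ++ 1 ∷ β)) ⟩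
  pinnacles (x ∷ u) ++ map (k +_) (pinnacles (α ++ 1 ∷ β)) ∎
  where
  open PermutationReasoning
  k+1≤n : k + 1 ≤ suc k
  k+1≤n = ≤-reflexive (+-comm k 1)

rest≥2 : ∀ {F} α β → α ++ β ↭ map suc (oneTo F) → All (2 ≤_) α × All (2 ≤_) β
rest≥2 α β rest = All.tabulate (≥2 ∘ ∈-++⁺ˡ) , All.tabulate (≥2 ∘ ∈-++⁺ʳ α)
  where
  ≥2 : ∀ {x} → x ∈ α ++ β → 2 ≤ x
  ≥2 x∈ with ∈-map⁻ suc (∈-resp-↭ rest x∈)
  ... | _ , y∈ , refl = s≤s (proj₁ (∈-oneTo⁻ y∈))

record SplitAtOne (F : ℕ) (τ : List ℕ) : Set where
  field
    before after : List ℕ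
    split        : τ ≡ before ++ 1 ∷ after
    before≥2     : All (2 ≤_) before
    after≥2      : All (2 ≤_) after
    rest         : before ++ after ↭ map suc (oneTo F)

splitAtOne : ∀ {F τ} → τ ↭ oneTo (suc F) → SplitAtOne F τ
splitAtOne {F} τ↭ with ∈-∃++ (∈-resp-↭ (↭-sym τ↭) (here refl))
... | α , β , refl = record { before = α ; after = β ; split = refl
                            ; before≥2 = proj₁ (rest≥2 α β rest) ; after≥2 = proj₂ (rest≥2 α β rest) ; rest = rest }
  where
  rest : α ++ β ↭ map suc (oneTo F)
  rest = drop-mid α [] (↭-trans τ↭ (↭-reflexive (oneTo-+ 1 F)))

module ProductFormula (k F : ℕ) {S₁ S₂ : List ℕ} (S₁-unique : Unique S₁)
                      (S₁-size : length S₁ + length S₁ + 1 ≡ suc k)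
                      (S₁-small : All (_≤ suc k) S₁) (S₂-above : All (2 ≤_) S₂) where

  open SmallRuns (suc k)

  Us Ts Σs : List (List ℕ)
  Us = withPinnacleSet (suc k) S₁
  Ts = withPinnacleSet (suc F) S₂
  Σs = withPinnacleSet (suc k + F) (S₁ ++ map (k +_) S₂)

  -- Giving N and s explicitly keeps Agda from unfolding withPinnacleSet while solving for them.
  ∈Σs⁻ : ∀ {σ} → σ ∈ Σs → σ ↭ oneTo (suc k + F) × pinnacles σ ∼[ set ] S₁ ++ map (k +_) S₂
  ∈Σs⁻ = ∈-withPinnacleSet⁻ {suc k + F} {S₁ ++ map (k +_) S₂}

  ∈Ts⁻ : ∀ {τ} → τ ∈ Ts → τ ↭ oneTo (suc F) × pinnacles τ ∼[ set ] S₂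
  ∈Ts⁻ = ∈-withPinnacleSet⁻ {suc F} {S₂}

  ∈Us⁻ : ∀ {u} → u ∈ Us → u ↭ oneTo (suc k) × pinnacles u ∼[ set ] S₁
  ∈Us⁻ = ∈-withPinnacleSet⁻ {suc k} {S₁}

  +k-injective : ∀ {a b} → k + a ≡ k + b → a ≡ b
  +k-injective = +-cancelˡ-≡ k _ _

  map-+k-large : ∀ γ → All (2 ≤_) γ → All (∁ (_≤ suc k)) (map (k +_) γ)
  map-+k-large γ γ≥2 = All.map <⇒≱ (shift-large k γ γ≥2)

  oneTo-glue : oneTo (suc k + F) ≡ oneTo (suc k) ++ map (k +_) (map suc (oneTo F))
  oneTo-glue = trans (oneTo-+ (suc k) F)
    (cong (oneTo (suc k) ++_) (trans (List.map-cong (λ x → sym (+-suc k x)) (oneTo F)) (List.map-∘ (oneTo F))))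

  glue-splitAtOne : ∀ {τ} u (s : SplitAtOne F τ) → let open SplitAtOne s in
                    glue k τ u ≡ map (k +_) before ++ u ++ map (k +_) after
  glue-splitAtOne u record { before = α ; after = β ; split = refl ; before≥2 = α≥2 ; after≥2 = β≥2 } =
    glue-split k u α β α≥2 β≥2

  glue-↭ : ∀ {τ u} → τ ↭ oneTo (suc F) → u ↭ oneTo (suc k) → glue k τ u ↭ oneTo (suc k + F)
  glue-↭ {τ} {u} τ↭ u↭ with splitAtOne τ↭
  ... | s@record { before = α ; after = β ; rest = rest } = begin
    glue k τ u                                      ≡⟨ glue-splitAtOne u s ⟩
    map (k +_) α ++ u ++ map (k +_) β               ↭⟨ shifts (map (k +_) α) u ⟩
    u ++ map (k +_) α ++ map (k +_) β               ≡⟨ cong (u ++_) (List.map-++ (k +_) α β) ⟨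
    u ++ map (k +_) (α ++ β)                        ↭⟨ ++⁺ u↭ (map⁺ (k +_) rest) ⟩
    oneTo (suc k) ++ map (k +_) (map suc (oneTo F)) ≡⟨ oneTo-glue ⟨
    oneTo (suc k + F)                               ∎
    where open PermutationReasoning

  pinnacles-glue-↭ : ∀ {τ u} → τ ↭ oneTo (suc F) → u ↭ oneTo (suc k) →
                     pinnacles (glue k τ u) ↭ pinnacles u ++ map (k +_) (pinnacles τ)
  pinnacles-glue-↭ {u = []}    _  u↭ = ⊥-elim (¬x∷xs↭[] (↭-sym u↭))
  pinnacles-glue-↭ {u = x ∷ u} τ↭ u↭ with splitAtOne τ↭
  ... | record { before = α ; after = β ; split = refl ; before≥2 = α≥2 ; after≥2 = β≥2 } =
    pinnacles-glue k u α β α≥2 β≥2 (All.tabulate (proj₂ ∘ ∈-oneTo-↭ u↭))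

  glue-pinnacleSet⁺ : ∀ {τ u} → τ ↭ oneTo (suc F) → u ↭ oneTo (suc k) → pinnacles u ∼[ set ] S₁ →
                      pinnacles τ ∼[ set ] S₂ → pinnacles (glue k τ u) ∼[ set ] S₁ ++ map (k +_) S₂
  glue-pinnacleSet⁺ τ↭ u↭ u∼ τ∼ =
    ∼set-trans (↭⇒∼set (pinnacles-glue-↭ τ↭ u↭)) (++-cong u∼ (map-cong (λ _ → refl) τ∼))

  glue-pinnacleSet⁻ : ∀ {τ u} → τ ↭ oneTo (suc F) → u ↭ oneTo (suc k) →
                      pinnacles (glue k τ u) ∼[ set ] S₁ ++ map (k +_) S₂ →
                      pinnacles u ∼[ set ] S₁ × pinnacles τ ∼[ set ] S₂
  glue-pinnacleSet⁻ {τ} {u} τ↭ u↭ σ∼ =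
    let u∼ , τ∼ = ++-∼set-split (All-pinnacles (All.tabulate (proj₂ ∘ ∈-oneTo-↭ u↭))) S₁-small
                    (map-+k-large _ (pinnacles-above (All.tabulate (proj₁ ∘ ∈-oneTo-↭ τ↭))))
                    (map-+k-large S₂ S₂-above)
                    (∼set-trans (∼set-sym (↭⇒∼set (pinnacles-glue-↭ τ↭ u↭))) σ∼)
    in u∼ , map-∼set⁻ +k-injective τ∼

  filter-glue : ∀ {τ u} → τ ↭ oneTo (suc F) → u ↭ oneTo (suc k) → filter (_≤? suc k) (glue k τ u) ≡ u
  filter-glue {u = u} τ↭ u↭ with splitAtOne τ↭
  ... | s@record { before = α ; after = β ; before≥2 = α≥2 ; after≥2 = β≥2 } =
    trans (cong (filter (_≤? suc k)) (glue-splitAtOne u s))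
      (filter-block (map (k +_) α) u (map (k +_) β) (shift-large k α α≥2) (All.tabulate (proj₂ ∘ ∈-oneTo-↭ u↭))
                    (shift-large k β β≥2))

  glue-injective : ∀ {τ τ′ u u′} → τ ↭ oneTo (suc F) → τ′ ↭ oneTo (suc F) →
                   u ↭ oneTo (suc k) → u′ ↭ oneTo (suc k) →
                   glue k τ u ≡ glue k τ′ u′ → τ ≡ τ′ × u ≡ u′
  glue-injective {u = []}    _   _    u↭ _   _  = ⊥-elim (¬x∷xs↭[] (↭-sym u↭))
  glue-injective {u = x ∷ u} τ↭ τ′↭ u↭ u′↭ eq
    with refl ← trans (sym (filter-glue τ↭ u↭)) (trans (cong (filter (_≤? suc k)) eq) (filter-glue τ′↭ u′↭))
    with splitAtOne τ↭ | splitAtOne τ′↭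
  ... | s@record { before = α ; after = β ; split = refl ; before≥2 = α≥2 }
      | s′@record { before = α′ ; after = β′ ; split = refl ; before≥2 = α′≥2 }
    with α≡ , rest≡ ← ++-∷-first-unique {P = _≤ suc k} (map-+k-large α α≥2) (map-+k-large α′ α′≥2)
                        (proj₂ (∈-oneTo-↭ u↭ (here refl))) (proj₂ (∈-oneTo-↭ u↭ (here refl)))
                        (trans (sym (glue-splitAtOne (x ∷ u) s)) (trans eq (glue-splitAtOne (x ∷ u) s′)))
    = cong₂ (λ a b → a ++ 1 ∷ b) (List.map-injective +k-injective α≡)
            (List.map-injective +k-injective (List.++-cancelˡ (x ∷ u) _ _ rest≡)) , refl

  unshift : ∀ γ → All (suc k <_) γ → map (k +_) (map (_∸ k) γ) ≡ γ
  unshift γ γ-large = trans (sym (List.map-∘ γ))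
    (List.map-id-local (All.map (λ k<a → m+[n∸m]≡n (≤-trans (n≤1+n k) (<⇒≤ k<a))) γ-large))

  map-∸-+ : ∀ xs → map (_∸ k) (map (k +_) xs) ≡ xs
  map-∸-+ xs = trans (sym (List.map-∘ xs)) (List.map-id-local (All.tabulate λ {x} _ → m+n∸m≡n k x))

  filter-oneTo : filter (_≤? suc k) (oneTo (suc k + F)) ≡ oneTo (suc k)
  filter-oneTo = trans (cong (filter (_≤? suc k)) oneTo-glue)
    (filter-block [] (oneTo (suc k)) _ [] (All.tabulate (proj₂ ∘ ∈-oneTo⁻))
                  (shift-large k _ (All.map⁺ (All.tabulate (s≤s ∘ proj₁ ∘ ∈-oneTo⁻)))))

  filter-small-↭ : ∀ {σ} → σ ↭ oneTo (suc k + F) → filter (_≤? suc k) σ ↭ oneTo (suc k)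
  filter-small-↭ σ↭ = ↭-trans (filter-↭ (_≤? suc k) σ↭) (↭-reflexive filter-oneTo)

  small-block : ∀ {σ} → σ ↭ oneTo (suc k + F) → S₁ ⊆ pinnacles σ → SmallBlock σ
  small-block {σ} σ↭ S₁⊆ = runCount≤1⇒block σ (runCount≤1 σ (length S₁) S₁≤ count)
    where
    S₁≤ : length S₁ ≤ smallCount (pinnacles σ)
    S₁≤ = Unique-⊆⇒length≤ S₁-unique λ v∈ → ∈-filter⁺ (_≤? suc k) (S₁⊆ v∈) (All.lookup S₁-small v∈)
    count : smallCount σ ≡ length S₁ + length S₁ + 1
    count = trans (↭-length (filter-small-↭ σ↭)) (trans (List.length-applyUpTo suc (suc k)) (sym S₁-size))

  module Ungluing {σ} (σ↭ : σ ↭ oneTo (suc k + F)) (b : SmallBlock σ) where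

    open SmallBlock b public using (block)
    open SmallBlock b using (before; after; split; before-large; block-small; after-large)

    block↭ : block ↭ oneTo (suc k)
    block↭ = subst (_↭ oneTo (suc k))
      (trans (cong (filter (_≤? suc k)) split) (filter-block before block after before-large block-small after-large))
      (filter-small-↭ σ↭)

    rest↭ : before ++ after ↭ map (k +_) (map suc (oneTo F))
    rest↭ = ++-cancelˡ-↭ (oneTo (suc k)) (begin
      oneTo (suc k) ++ before ++ after                 ↭⟨ ++⁺ (↭-sym block↭) ↭-refl ⟩
      block ++ before ++ after                         ↭⟨ shifts block before ⟩
      before ++ block ++ after                         ≡⟨ split ⟨
      σ                                                ↭⟨ σ↭ ⟩
      oneTo (suc k + F)                                ≡⟨ oneTo-glue ⟩
      oneTo (suc k) ++ map (k +_) (map suc (oneTo F))  ∎)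
      where open PermutationReasoning

    α β τ : List ℕ
    α = map (_∸ k) before
    β = map (_∸ k) after
    τ = α ++ 1 ∷ β

    αβ↭ : α ++ β ↭ map suc (oneTo F)
    αβ↭ = begin
      α ++ β                                         ≡⟨ List.map-++ (_∸ k) before after ⟨
      map (_∸ k) (before ++ after)                   ↭⟨ map⁺ (_∸ k) rest↭ ⟩
      map (_∸ k) (map (k +_) (map suc (oneTo F)))    ≡⟨ map-∸-+ (map suc (oneTo F)) ⟩
      map suc (oneTo F)                              ∎
      where open PermutationReasoning

    τ↭ : τ ↭ oneTo (suc F)
    τ↭ = ↭-trans (shift 1 α β) (↭-trans (prep 1 αβ↭) (↭-reflexive (sym (oneTo-+ 1 F))))

    σ≡glue : σ ≡ glue k τ block
    σ≡glue = begin
      σ                                      ≡⟨ split ⟩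
      before ++ block ++ after               ≡⟨ cong₂ (λ a b → a ++ block ++ b) (unshift before before-large)
                                                                                (unshift after after-large) ⟨
      map (k +_) α ++ block ++ map (k +_) β  ≡⟨ glue-split k block α β (proj₁ (rest≥2 α β αβ↭))
                                                                       (proj₂ (rest≥2 α β αβ↭)) ⟨
      glue k τ block                         ∎
      where open ≡-Reasoning

  unglue : ∀ {σ} → σ ∈ Σs → ∃₂ λ τ u → τ ∈ Ts × u ∈ Us × σ ≡ glue k τ u
  unglue {σ} σ∈ =
    let σ↭ , σ∼ = ∈Σs⁻ σ∈
        open Ungluing σ↭ (small-block σ↭ λ v∈ → Equivalence.from σ∼ (∈-++⁺ˡ v∈))
        u∼ , τ∼ = glue-pinnacleSet⁻ τ↭ block↭
                    (subst (λ σ → pinnacles σ ∼[ set ] S₁ ++ map (k +_) S₂) σ≡glue σ∼)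
    in τ , block , ∈-withPinnacleSet⁺ τ↭ τ∼ , ∈-withPinnacleSet⁺ block↭ u∼ , σ≡glue

  glued : List (List ℕ)
  glued = cartesianProductWith (glue k) Ts Us

  glued-unique : Unique glued
  glued-unique = cartesianProductWith-unique (glue k)
    (λ τ∈ τ′∈ u∈ u′∈ → glue-injective (proj₁ (∈Ts⁻ τ∈)) (proj₁ (∈Ts⁻ τ′∈))
                                     (proj₁ (∈Us⁻ u∈)) (proj₁ (∈Us⁻ u′∈)))
    (withPinnacleSet-unique (suc F) S₂) (withPinnacleSet-unique (suc k) S₁)

  Σs∼glued : Σs ∼[ set ] glued
  Σs∼glued = mk⇔ to from
    where
    to : ∀ {σ} → σ ∈ Σs → σ ∈ glued
    to σ∈ = let _ , _ , τ∈ , u∈ , σ≡ = unglue σ∈ in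
            subst (_∈ glued) (sym σ≡) (∈-cartesianProductWith⁺ (glue k) τ∈ u∈)
    from : ∀ {σ} → σ ∈ glued → σ ∈ Σs
    from σ∈ with τ , u , τ∈ , u∈ , refl ← ∈-cartesianProductWith⁻ (glue k) Ts Us σ∈ =
      let τ↭ , τ∼ = ∈Ts⁻ τ∈ ; u↭ , u∼ = ∈Us⁻ u∈ in
      ∈-withPinnacleSet⁺ {suc k + F} {S₁ ++ map (k +_) S₂} (glue-↭ τ↭ u↭) (glue-pinnacleSet⁺ τ↭ u↭ u∼ τ∼)

  pN-glue : pN (suc k + F) (S₁ ++ map (k +_) S₂) ≡ pN (suc k) S₁ * pN (suc F) S₂
  pN-glue = begin
    length Σs                ≡⟨ Unique-∼set⇒length≡ (withPinnacleSet-unique (suc k + F) (S₁ ++ map (k +_) S₂))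
                                                      glued-unique Σs∼glued ⟩
    length glued             ≡⟨ length-cartesianProductWith (glue k) Ts Us ⟩
    length Ts * length Us    ≡⟨ *-comm (length Ts) (length Us) ⟩
    length Us * length Ts    ∎
    where open ≡-Reasoning

size-suc : ∀ t → ∃ λ k → size t ≡ suc k
size-suc leaf       = 0 , refl
size-suc (node l r) = size l + size r , +-comm (size l + size r) 1

mainTheorem9 : (T₁ : Tree) (Ts : List Tree) →
    p (T₁ ∷ Ts) ≡ p (T₁ ∷ []) * p (leaf ∷ Ts)
mainTheorem9 T₁ Ts with k , size≡ ← size-suc T₁ = begin
  p (T₁ ∷ Ts)                                ≡⟨ cong₂ pN (cong (_+ F) size≡) (cong (S₁ ++_) labels-shift) ⟩
  pN (suc k + F) (S₁ ++ map (k +_) S₂)       ≡⟨ ProductFormula.pN-glue k F (internalsT-unique 0 T₁)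
                                                   (trans (internalsT-length 0 T₁) size≡)
                                                   (All.tabulate (subst (_ ≤_) size≡ ∘ proj₂ ∘ internalsT-bounds 0 T₁))
                                                   (All.tabulate (internalsF-lowerBound 1 Ts)) ⟩
  pN (suc k) S₁ * pN (suc F) S₂              ≡⟨ cong (_* p (leaf ∷ Ts)) single-tree ⟨
  p (T₁ ∷ []) * p (leaf ∷ Ts)                ∎
  where
  open ≡-Reasoning
  F : ℕ
  F  = forestSize Ts
  S₁ S₂ : List ℕ
  S₁ = internalsT 0 T₁
  S₂ = internalsF 1 Ts
  labels-shift : internalsF (size T₁) Ts ≡ map (k +_) S₂
  labels-shift = trans (cong (λ m → internalsF m Ts) (trans size≡ (+-comm 1 k))) (internalsF-shift k 1 Ts)
  single-tree : p (T₁ ∷ []) ≡ pN (suc k) S₁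
  single-tree = cong₂ pN (trans (+-identityʳ (size T₁)) size≡) (List.++-identityʳ S₁)
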